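{- Any unicellular fatgraph $\mathbb{G}$ of (Euler) genus $g$ has r-distance $d(\mathbb{G})\ge g$.
   Context: A fatgraph with $n$ ribbons is $\mathbb{G}=([2n+1],\sigma,\gamma,\omega)$: sectors $[2n+1]$; permutations $\sigma,\gamma$ whose cycles are vertices and boundary components, $\sigma(2n+1)=\gamma(2n+1)=1$; orientations $\omega:[2n+1]\to\{\pm1\}$, $\omega(1)=\omega(2n+1)$; the pairs $(x,\sigma(x))$, $x\ne2n+1$, are matched into ribbons (untwisted: $x,\sigma(y)$ and $\sigma(x),y$ $\gamma$-consecutive with $\omega(x)=\omega(\sigma(y))$, $\omega(\sigma(x))=\omega(y)$; twisted: $x,y$ and $\sigma(x),\sigma(y)$ $\gamma$-consecutive with $\omega(x)=-\omega(y)$, $\omega(\sigma(x))=-\omega(\sigma(y))$). Euler genus: $2-g=v-e+b$ (numbers of vertices, ribbons, boundary components). Unicellular: $\gamma$ a single cycle, $=(1,\dots,2n+1)$, $<_\gamma$ the usual order. Flipping a vertex reverses its cyclic order and changes orientations of its sectors. Reversals along sectors $i<_\gamma j$: gluing (distinct vertices $(i,i_1,\dots,i_p),(j,j_1,\dots,j_q)$, after flipping $\omega(i)=-\omega(j)$, replaced by $(i,j_1,\dots,j_q,j,i_1,\dots,i_p)$); slicing (vertex $(i,j_1,\dots,j_q,j,i_1,\dots,i_p)$ with $\omega(i)=-\omega(j)$ replaced by $(i,i_1,\dots,i_p)$ and $(j,j_1,\dots,j_q)$); half-flipping (same vertex with $\omega(i)=\omega(j)$ replaced by $(i,j_q,\dots,j_1,j,i_1,\dots,i_p)$).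 The r-distance $d(\mathbb{G})$ is the minimum number of reversals transforming $\mathbb{G}$ into a unicellular fatgraph of genus $0$. -}

module Defs where

open import Data.Nat as ℕ using (ℕ; zero; suc; _*_; _<_; _≤_; _%_)
open import Data.Integer as ℤ using (ℤ; +_)
open import Data.Fin using (Fin; toℕ; fromℕ; zero)
open import Data.Fin.Properties using (all?)
open import Data.Fin.Permutation using (Permutation′; _⟨$⟩ʳ_)
open import Data.List using (List; []; _∷_; _++_; reverse; length; filter)
open import Data.List.Membership.Propositional using (_∈_; _∉_)
open import Data.List.Relation.Unary.Unique.Propositional using (Unique)
open import Data.List.Base using () renaming (allFin to lAllFin)
open import Data.Sign using (Sign; opposite)
open import Data.Product using (Σ; _×_; _,_; ∃)
open import Data.Sum using (_⊎_)
open import Data.Empty using (⊥)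
open import Relation.Binary.PropositionalEquality using (_≡_; _≢_)
open import Relation.Nullary using (Dec; ¬_)
open import Data.Nat.Properties using (_≤?_)

-- A fatgraph with n ribbons has 2n+1 sectors; the paper's
-- sector k+1 (k = 0 … 2n) is represented by  k : Fin (2n+1).
-- So the paper's sector 1 is  zero  and sector 2n+1 is  fromℕ (2 * n).

Sec : ℕ → Set
Sec n = Fin (suc (2 * n))

lastSec : (n : ℕ) → Sec n
lastSec n = fromℕ (2 * n)

firstSec : (n : ℕ) → Sec n
firstSec n = zero

-- Cycles of a function.  IsCycle f (a₀ ∷ a₁ ∷ … ∷ aₘ) says that
-- (a₀,a₁,…,aₘ) is a cycle of f, i.e. f a₀ = a₁, …, f aₘ = a₀, with the
-- aₖ pairwise distinct.

Closes : ∀ {A : Set} → (A → A) → A → List A → Set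
Closes f s []            = ⊥
Closes f s (a ∷ [])      = f a ≡ s
Closes f s (a ∷ b ∷ l)   = f a ≡ b × Closes f s (b ∷ l)

IsCycle : ∀ {A : Set} → (A → A) → List A → Set
IsCycle f []      = ⊥
IsCycle f (a ∷ l) = Closes f a (a ∷ l) × Unique (a ∷ l)

iter : ∀ {A : Set} → (A → A) → ℕ → A → A
iter f zero    x = x
iter f (suc k) x = iter f k (f x)

-- x is the least element of its f-orbit (orbits have size ≤ N)
IsOrbitMin : ∀ {N} → (Fin N → Fin N) → Fin N → Set
IsOrbitMin {N} f x = ∀ (k : Fin N) → toℕ x ≤ toℕ (iter f (toℕ k) x)

isOrbitMin? : ∀ {N} (f : Fin N → Fin N) (x : Fin N) → Dec (IsOrbitMin f x)
isOrbitMin? f x = all? (λ k → toℕ x ≤? toℕ (iter f (toℕ k) x))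

numCycles : ∀ {N} → Permutation′ N → ℕ
numCycles {N} π = length (filter (isOrbitMin? (π ⟨$⟩ʳ_)) (lAllFin N))

Consec : ∀ {N} → Permutation′ N → Fin N → Fin N → Set
Consec γ a b = (γ ⟨$⟩ʳ a ≡ b) ⊎ (γ ⟨$⟩ʳ b ≡ a)

IsRibbon : ∀ {N} → Permutation′ N → Permutation′ N → (Fin N → Sign) →
           Fin N → Fin N → Set
IsRibbon σ γ ω x y =
    -- untwisted
    ( Consec γ x (σ ⟨$⟩ʳ y) × Consec γ (σ ⟨$⟩ʳ x) y
    × ω x ≡ ω (σ ⟨$⟩ʳ y) × ω (σ ⟨$⟩ʳ x) ≡ ω y )
  ⊎ -- twisted
    ( Consec γ x y × Consec γ (σ ⟨$⟩ʳ x) (σ ⟨$⟩ʳ y)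
    × ω x ≡ opposite (ω y) × ω (σ ⟨$⟩ʳ x) ≡ opposite (ω (σ ⟨$⟩ʳ y)) )

record Fatgraph (n : ℕ) : Set where
  field
    σ γ    : Permutation′ (suc (2 * n))
    ω      : Sec n → Sign
    σ-last : σ ⟨$⟩ʳ lastSec n ≡ firstSec n
    γ-last : γ ⟨$⟩ʳ lastSec n ≡ firstSec n
    ω-ends : ω (firstSec n) ≡ ω (lastSec n)
    -- the pairs (x,σx), x ≠ 2n+1, are matched into ribbons by the
    -- fixed-point-free involution ρ on sectors ≠ 2n+1
    ρ         : Sec n → Sec n
    ρ-closed  : ∀ x → x ≢ lastSec n → ρ x ≢ lastSec n
    ρ-nofix   : ∀ x → x ≢ lastSec n → ρ x ≢ x
    ρ-invol   : ∀ x → x ≢ lastSec n → ρ (ρ x) ≡ x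
    ρ-ribbon  : ∀ x → x ≢ lastSec n → IsRibbon σ γ ω x (ρ x)

open Fatgraph public

-- Euler genus: 2 - g = v - e + b, i.e. g = 2 - v + e - b
genus : ∀ {n} → Fatgraph n → ℤ
genus {n} G =
  ((+ 2 ℤ.- + numCycles (σ G)) ℤ.+ + n) ℤ.- + numCycles (γ G)

IsUnicellular : ∀ {n} → Fatgraph n → Set
IsUnicellular {n} G =
  ∀ (x : Sec n) → toℕ (γ G ⟨$⟩ʳ x) ≡ suc (toℕ x) % suc (2 * n)

FlippedOn : ∀ {n} → (Sec n → Sign) → List (Sec n) → (Sec n → Sign) → Set
FlippedOn ω l ω₁ = (∀ x → x ∈ l → ω₁ x ≡ opposite (ω x))
                 × (∀ x → x ∉ l → ω₁ x ≡ ω x)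

Agrees : ∀ {n} → Fatgraph n → Fatgraph n → List (Sec n) → (Sec n → Sign) → Set
Agrees G G' S ω₁ =
    (∀ x → x ∉ S → σ G' ⟨$⟩ʳ x ≡ σ G ⟨$⟩ʳ x)
  × (∀ x → γ G' ⟨$⟩ʳ x ≡ γ G ⟨$⟩ʳ x)
  × (∀ x → ω G' x ≡ ω₁ x)

-- Optional flip of the vertex (i ∷ I) or of the vertex (j ∷ J) before a
-- gluing: I' , J' are the resulting cycle tails and ω₁ the orientations.
PreFlip : ∀ {n} → (Sec n → Sign) → Sec n → List (Sec n) → Sec n → List (Sec n) →
          List (Sec n) → List (Sec n) → (Sec n → Sign) → Set
PreFlip {n} ω i I j J I' J' ω₁ =
    (I' ≡ I × J' ≡ J × (∀ x → ω₁ x ≡ ω x))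
  ⊎ (I' ≡ reverse I × J' ≡ J × FlippedOn {n} ω (i ∷ I) ω₁)
  ⊎ (I' ≡ I × J' ≡ reverse J × FlippedOn {n} ω (j ∷ J) ω₁)

-- a single reversal along sectors i <_γ j (γ is the usual order, as the
-- fatgraphs considered are unicellular and γ is never changed)
data Reversal {n : ℕ} (G G' : Fatgraph n) : Set where
  gluing : ∀ (i j : Sec n) (I J I' J' : List (Sec n)) (ω₁ : Sec n → Sign) →
    toℕ i < toℕ j →
    IsCycle (σ G ⟨$⟩ʳ_) (i ∷ I) → IsCycle (σ G ⟨$⟩ʳ_) (j ∷ J) →
    j ∉ (i ∷ I) →
    PreFlip {n} (ω G) i I j J I' J' ω₁ →
    ω₁ i ≡ opposite (ω₁ j) →
    IsCycle (σ G' ⟨$⟩ʳ_) (i ∷ J' ++ j ∷ I') →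
    Agrees G G' (i ∷ I ++ j ∷ J) ω₁ →
    Reversal G G'
  slicing : ∀ (i j : Sec n) (I J : List (Sec n)) →
    toℕ i < toℕ j →
    IsCycle (σ G ⟨$⟩ʳ_) (i ∷ J ++ j ∷ I) →
    ω G i ≡ opposite (ω G j) →
    IsCycle (σ G' ⟨$⟩ʳ_) (i ∷ I) → IsCycle (σ G' ⟨$⟩ʳ_) (j ∷ J) →
    Agrees G G' (i ∷ J ++ j ∷ I) (ω G) →
    Reversal G G'
  half-flipping : ∀ (i j : Sec n) (I J : List (Sec n)) →
    toℕ i < toℕ j →
    IsCycle (σ G ⟨$⟩ʳ_) (i ∷ J ++ j ∷ I) →
    ω G i ≡ ω G j →
    IsCycle (σ G' ⟨$⟩ʳ_) (i ∷ reverse J ++ j ∷ I) →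
    Agrees G G' (i ∷ J ++ j ∷ I) (ω G) →
    Reversal G G'

data Reversals {n : ℕ} : ℕ → Fatgraph n → Fatgraph n → Set where
  done : ∀ {G} → Reversals zero G G
  step : ∀ {k G G' G''} → Reversal G G' → Reversals k G' G'' →
         Reversals (suc k) G G''

RDistanceAtLeast : ∀ {n} → Fatgraph n → ℤ → Set
RDistanceAtLeast {n} G m =
  ∀ (k : ℕ) (H : Fatgraph n) → Reversals k G H →
    IsUnicellular H → genus H ≡ + 0 → m ℤ.≤ + k

module Submission where

-- Each reversal lowers the Euler genus by at most one, so reaching genus 0
-- from genus g takes at least g reversals.
--
-- A reversal keeps the boundary permutation γ and the number of ribbons, and
-- only rearranges the vertices (cycles of σ) through the sectors i, j: it
-- replaces one or two σ-cycles by one or two new cycles covering the same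
-- sectors.  The number of vertices v therefore grows by at most one, and since
-- g = 2 - v + e - b the genus drops by at most one.
--
-- Cycles of a permutation of Fin N are counted, as in the definition of
-- numCycles, by their least elements ("orbit minima").

open import Defs
open import Algebra.Properties.CommutativeSemigroup using (interchange)
open import Data.Nat as ℕ using (ℕ; zero; suc; _+_; _∸_; _≤_; _<_; z≤n; s≤s; z<s; s<s)
open import Data.Nat.Properties
open import Data.Integer as ℤ using (ℤ)
import Data.Integer.Properties as ℤP
open import Data.Integer.Tactic.RingSolver using (solve-∀)
open import Data.Fin using (Fin; toℕ; fromℕ<)
open import Data.Fin.Properties using (toℕ-injective; toℕ-fromℕ<) renaming (_≟_ to _≟F_)
open import Data.Fin.Permutation using (Permutation′; _⟨$⟩ʳ_; _⟨$⟩ˡ_; inverseˡ)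
open import Data.List using (List; []; _∷_; _++_; length; filter)
open import Data.List.Base using () renaming (allFin to allFinList)
open import Data.List.Properties using (length-++; length-tabulate; filter-≐)
open import Data.List.Extrema ≤-totalOrder using (argmin; argmin-sel; f[argmin]≤f[⊤]; f[argmin]≤f[xs])
open import Data.List.Membership.Propositional using (_∈_; _∉_)
open import Data.List.Relation.Binary.Subset.Propositional using (_⊆_)
open import Data.List.Relation.Binary.Subset.Propositional.Properties using (∷⁺ʳ; ++⁺ˡ)
open import Data.List.Membership.Propositional.Properties using (∈-++⁺ˡ; ∈-++⁺ʳ; ∈-++⁻; ∈-∃++; ∈-allFin)
open import Data.List.Relation.Unary.Any using (here; there; any?)
open import Data.List.Relation.Unary.Any.Properties using (reverse⁺)
import Data.List.Relation.Unary.All as All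
open import Data.List.Relation.Unary.AllPairs using (_∷_)
open import Data.List.Relation.Unary.Unique.Propositional using (Unique)
open import Data.List.Relation.Unary.Unique.Propositional.Properties using (allFin⁺)
open import Data.Product using (_×_; _,_; ∃; proj₁; proj₂)
open import Data.Sum using (_⊎_; inj₁; inj₂)
open import Data.Empty using (⊥-elim)
open import Relation.Binary.PropositionalEquality
open import Relation.Nullary using (Dec; yes; no)
open import Relation.Unary using (Pred; Decidable)
open import Level using (0ℓ)

iter-+ : ∀ {A : Set} (f : A → A) p q x → iter f (p + q) x ≡ iter f q (iter f p x)
iter-+ f zero    q x = refl
iter-+ f (suc p) q x = iter-+ f p q (f x)

iter-agree : ∀ {A : Set} (f g : A → A) (S : List A) →
  (∀ {y} → f y ∈ S → y ∈ S) → (∀ {x} → x ∉ S → g x ≡ f x) →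
  ∀ k {x} → x ∉ S → iter g k x ≡ iter f k x
iter-agree f g S closed agree zero    x∉S = refl
iter-agree f g S closed agree (suc k) {x} x∉S =
  trans (cong (iter g k) (agree x∉S)) (iter-agree f g S closed agree k (λ fx∈S → x∉S (closed fx∈S)))

module _ {A : Set} (f : A → A) where

  closes-return : ∀ {s a} l → Closes f s (a ∷ l) → iter f (length (a ∷ l)) a ≡ s
  closes-return []      fa≡s       = fa≡s
  closes-return (b ∷ l) (refl , c) = closes-return l c

  closes-position : ∀ {s a} l → Closes f s (a ∷ l) →
    ∀ {y} → y ∈ a ∷ l → ∃ λ q → q < length (a ∷ l) × iter f q a ≡ y
  closes-position l       c          (here refl) = 0 , z<s , refl
  closes-position (b ∷ l) (refl , c) (there y∈) with closes-position l c y∈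
  ... | q , q< , e = suc q , s<s q< , e

  closes-successor : ∀ {s a} l → Closes f s (a ∷ l) → ∀ {z} → z ∈ a ∷ l → f z ≡ s ⊎ f z ∈ l
  closes-successor []      fa≡s       (here refl) = inj₁ fa≡s
  closes-successor (b ∷ l) (refl , c) (here refl) = inj₂ (here refl)
  closes-successor (b ∷ l) (refl , c) (there z∈) with closes-successor l c z∈
  ... | inj₁ e  = inj₁ e
  ... | inj₂ fz∈ = inj₂ (there fz∈)

  closes-predecessor : ∀ {s a} l → Closes f s (a ∷ l) →
    ∀ {w} → w ≡ s ⊎ w ∈ l → ∃ λ z → z ∈ a ∷ l × f z ≡ w
  closes-predecessor []      fa≡s       (inj₁ refl)        = _ , here refl , fa≡s
  closes-predecessor (b ∷ l) (refl , c) (inj₂ (here refl)) = _ , here refl , refl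
  closes-predecessor (b ∷ l) (refl , c) (inj₁ e) with closes-predecessor l c (inj₁ e)
  ... | z , z∈ , fz≡w = z , there z∈ , fz≡w
  closes-predecessor (b ∷ l) (refl , c) (inj₂ (there w∈)) with closes-predecessor l c (inj₂ w∈)
  ... | z , z∈ , fz≡w = z , there z∈ , fz≡w

  cycle-successor : ∀ {C} → IsCycle f C → ∀ {z} → z ∈ C → f z ∈ C
  cycle-successor {a ∷ l} (c , _) z∈ with closes-successor l c z∈
  ... | inj₁ e   = here e
  ... | inj₂ fz∈ = there fz∈

  cycle-iterate : ∀ {C} → IsCycle f C → ∀ k {z} → z ∈ C → iter f k z ∈ C
  cycle-iterate cyc zero    z∈ = z∈
  cycle-iterate cyc (suc k) z∈ = cycle-iterate cyc k (cycle-successor cyc z∈)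

  cycle-predecessor : ∀ {C} → IsCycle f C → ∀ {w} → w ∈ C → ∃ λ z → z ∈ C × f z ≡ w
  cycle-predecessor {a ∷ l} (c , _) (here e)   = closes-predecessor l c (inj₁ e)
  cycle-predecessor {a ∷ l} (c , _) (there w∈) = closes-predecessor l c (inj₂ w∈)

  cycle-reach : ∀ {C} → IsCycle f C → ∀ {x y} → x ∈ C → y ∈ C →
    ∃ λ k → k < length C × iter f k x ≡ y
  cycle-reach {a ∷ l} (c , _) x∈ y∈
    with closes-position l c x∈ | closes-position l c y∈
  ... | p , p<L , refl | q , q<L , refl with p ℕ.≤? q
  ... | yes p≤q = q ∸ p , ≤-<-trans (m∸n≤m q p) q<L , shift (m+[n∸m]≡n p≤q)
    where
    shift : ∀ {d t} → p + d ≡ t → iter f d (iter f p a) ≡ iter f t a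
    shift refl = sym (iter-+ f p _ a)
  ... | no p≰q = (L ∸ p) + q , wrap-bound , (begin
      iter f ((L ∸ p) + q) (iter f p a) ≡⟨ sym (iter-+ f p _ a) ⟩
      iter f (p + ((L ∸ p) + q)) a      ≡⟨ cong (λ t → iter f t a) wrap ⟩
      iter f (L + q) a                  ≡⟨ iter-+ f L q a ⟩
      iter f q (iter f L a)             ≡⟨ cong (iter f q) (closes-return l c) ⟩
      iter f q a                        ∎)
    where
    open ≡-Reasoning
    L : ℕ
    L = length (a ∷ l)
    wrap : p + ((L ∸ p) + q) ≡ L + q
    wrap = trans (sym (+-assoc p (L ∸ p) q)) (cong (_+ q) (m+[n∸m]≡n (<⇒≤ p<L)))
    wrap-bound : (L ∸ p) + q < L
    wrap-bound = subst ((L ∸ p) + q <_) (m∸n+n≡m (<⇒≤ p<L)) (+-monoʳ-< (L ∸ p) (≰⇒> p≰q))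

cycle-preimage : ∀ {A : Set} (f : A → A) → (∀ {x y} → f x ≡ f y → x ≡ y) →
  ∀ {C} → IsCycle f C → ∀ {y} → f y ∈ C → y ∈ C
cycle-preimage f injective cyc fy∈ with cycle-predecessor f cyc fy∈
... | z , z∈ , fz≡fy = subst (_∈ _) (injective fz≡fy) z∈

permutation-injective : ∀ {N} (π : Permutation′ N) {x y} → π ⟨$⟩ʳ x ≡ π ⟨$⟩ʳ y → x ≡ y
permutation-injective π {x} {y} e =
  trans (sym (inverseˡ π)) (trans (cong (π ⟨$⟩ˡ_) e) (inverseˡ π))

unique-length≤ : ∀ {A : Set} {xs ys : List A} → Unique xs → xs ⊆ ys → length xs ≤ length ys
unique-length≤ {xs = []}     _          _   = z≤n
unique-length≤ {xs = x ∷ xs} (x∉ ∷ uxs) sub with ∈-∃++ (sub (here refl))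
... | us , vs , refl = begin
  suc (length xs)             ≤⟨ s≤s (unique-length≤ uxs sub′) ⟩
  suc (length (us ++ vs))     ≡⟨ cong suc (length-++ us) ⟩
  suc (length us + length vs) ≡⟨ sym (+-suc (length us) (length vs)) ⟩
  length us + length (x ∷ vs) ≡⟨ sym (length-++ us) ⟩
  length (us ++ x ∷ vs)       ∎
  where
  open ≤-Reasoning
  sub′ : xs ⊆ us ++ vs
  sub′ z∈ with ∈-++⁻ us (sub (there z∈))
  ... | inj₁ z∈us         = ∈-++⁺ˡ z∈us
  ... | inj₂ (here z≡x)   = ⊥-elim (All.lookup x∉ z∈ (sym z≡x))
  ... | inj₂ (there z∈vs) = ∈-++⁺ʳ us z∈vs

cycle-length≤ : ∀ {N} (f : Fin N → Fin N) {C} → IsCycle f C → length C ≤ N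
cycle-length≤ {N} f {a ∷ l} (_ , unique) =
  subst (length (a ∷ l) ≤_) (length-tabulate (λ x → x)) (unique-length≤ unique (λ {z} _ → ∈-allFin z))

IsMinimumOf : ∀ {N} → Fin N → List (Fin N) → Set
IsMinimumOf m C = m ∈ C × (∀ {y} → y ∈ C → toℕ m ≤ toℕ y)

cycle-minimum : ∀ {N} (f : Fin N → Fin N) {C} → IsCycle f C → ∃ λ m → IsMinimumOf m C
cycle-minimum f {a ∷ l} _ = m , m∈ , least
  where
  m : Fin _
  m = argmin toℕ a l
  m∈ : m ∈ a ∷ l
  m∈ with argmin-sel toℕ a l
  ... | inj₁ m≡a = here m≡a
  ... | inj₂ m∈l = there m∈l
  least : ∀ {y} → y ∈ a ∷ l → toℕ m ≤ toℕ y
  least (here refl) = f[argmin]≤f[⊤] {f = toℕ} a l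
  least (there y∈l) = All.lookup (f[argmin]≤f[xs] {f = toℕ} a l) y∈l

minimum-is-orbitMin : ∀ {N} (f : Fin N → Fin N) {C m} → IsCycle f C → IsMinimumOf m C →
  IsOrbitMin f m
minimum-is-orbitMin f cyc (m∈ , least) k = least (cycle-iterate f cyc (toℕ k) m∈)

-- … and the only orbit minimum lying on that cycle: from any x on the cycle
-- the minimum is reached in fewer than N steps.
orbitMin-on-cycle : ∀ {N} (f : Fin N → Fin N) {C m x} → IsCycle f C → IsMinimumOf m C →
  x ∈ C → IsOrbitMin f x → x ≡ m
orbitMin-on-cycle {N} f {m = m} {x = x} cyc (m∈ , least) x∈ x-min with cycle-reach f cyc x∈ m∈
... | k , k<L , reach-m = toℕ-injective (≤-antisym x≤m (least x∈))
  where
  k<N : k < N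
  k<N = <-≤-trans k<L (cycle-length≤ f cyc)
  x≤m : toℕ x ≤ toℕ m
  x≤m = subst (λ y → toℕ x ≤ toℕ y) reach-m
          (subst (λ t → toℕ x ≤ toℕ (iter f t x)) (toℕ-fromℕ< k<N) (x-min (fromℕ< k<N)))

𝟙 : ∀ {P : Set} → Dec P → ℕ
𝟙 (yes _) = 1
𝟙 (no _)  = 0

𝟙-holds : ∀ {P : Set} (d : Dec P) → P → 1 ≤ 𝟙 d
𝟙-holds (yes _) _ = ≤-refl
𝟙-holds (no ¬p) p = ⊥-elim (¬p p)

count : ∀ {A : Set} {P : Pred A 0ℓ} → Decidable P → List A → ℕ
count P? xs = length (filter P? xs)

total : ∀ {A : Set} → (A → ℕ) → List A → ℕ
total w []       = 0
total w (x ∷ xs) = w x + total w xs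

count-as-total : ∀ {A : Set} {P : Pred A 0ℓ} (P? : Decidable P) xs →
  count P? xs ≡ total (λ x → 𝟙 (P? x)) xs
count-as-total P? []       = refl
count-as-total P? (x ∷ xs) with P? x
... | yes _ = cong suc (count-as-total P? xs)
... | no _  = count-as-total P? xs

total-mono : ∀ {A : Set} {u v : A → ℕ} → (∀ x → u x ≤ v x) → ∀ xs → total u xs ≤ total v xs
total-mono u≤v []       = z≤n
total-mono u≤v (x ∷ xs) = +-mono-≤ (u≤v x) (total-mono u≤v xs)

total-+ : ∀ {A : Set} (u v : A → ℕ) xs → total (λ x → u x + v x) xs ≡ total u xs + total v xs
total-+ u v []       = refl
total-+ u v (x ∷ xs) = trans (cong (u x + v x +_) (total-+ u v xs))
                             (interchange +-commutativeSemigroup (u x) (v x) (total u xs) (total v xs))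

total-absent : ∀ {N} {z : Fin N} {xs} → z ∉ xs → total (λ x → 𝟙 (x ≟F z)) xs ≡ 0
total-absent {xs = []} _ = refl
total-absent {z = z} {xs = x ∷ xs} z∉ with x ≟F z
... | yes refl = ⊥-elim (z∉ (here refl))
... | no _     = total-absent (λ z∈ → z∉ (there z∈))

total-point : ∀ {N} {z : Fin N} {xs} → Unique xs → z ∈ xs → total (λ x → 𝟙 (x ≟F z)) xs ≡ 1
total-point {z = z} {xs = x ∷ xs} (x∉ ∷ _) z∈ with x ≟F z
total-point {xs = x ∷ xs} (x∉ ∷ _)    _          | yes refl = cong suc (total-absent (λ x∈ → All.lookup x∉ x∈ refl))
total-point {xs = x ∷ xs} _           (here z≡x) | no x≢z   = ⊥-elim (x≢z (sym z≡x))
total-point {xs = x ∷ xs} (_ ∷ uxs)   (there z∈) | no _     = total-point uxs z∈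

total-point-allFin : ∀ {N} (z : Fin N) → total (λ x → 𝟙 (x ≟F z)) (allFinList N) ≡ 1
total-point-allFin {N} z = total-point (allFin⁺ N) (∈-allFin z)

-- Pointwise,
-- [P x] + [x = m] ≤ [Q x] + [x = a] + [x = b]; summing gives #P + 1 ≤ #Q + 2.
count-exchange : ∀ {N} {P Q : Pred (Fin N) 0ℓ} (P? : Decidable P) (Q? : Decidable Q) {a b m : Fin N} →
  (∀ {x} → P x → Q x ⊎ (x ≡ a ⊎ x ≡ b)) → Q m → (P m → m ≡ a ⊎ m ≡ b) →
  count P? (allFinList N) ≤ suc (count Q? (allFinList N))
count-exchange {N} {P} {Q} P? Q? {a} {b} {m} P⇒Q∨ab Qm Pm⇒ab = ≤-pred (begin
  suc (count P? xs)                            ≡⟨ +-comm 1 (count P? xs) ⟩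
  count P? xs + 1                              ≡⟨ cong₂ _+_ (count-as-total P? xs) (sym (total-point-allFin m)) ⟩
  total 𝟙P xs + total (is m) xs                ≡⟨ sym (total-+ 𝟙P (is m) xs) ⟩
  total (λ x → 𝟙P x + is m x) xs               ≤⟨ total-mono weights xs ⟩
  total (λ x → 𝟙Q x + (is a x + is b x)) xs    ≡⟨ total-+ 𝟙Q _ xs ⟩
  total 𝟙Q xs + total (λ x → is a x + is b x) xs ≡⟨ cong (total 𝟙Q xs +_) (total-+ (is a) (is b) xs) ⟩
  total 𝟙Q xs + (total (is a) xs + total (is b) xs)
    ≡⟨ cong₂ (λ c d → c + (d + total (is b) xs)) (sym (count-as-total Q? xs)) (total-point-allFin a) ⟩
  count Q? xs + suc (total (is b) xs)          ≡⟨ cong (λ d → count Q? xs + suc d) (total-point-allFin b) ⟩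
  count Q? xs + 2                              ≡⟨ +-comm (count Q? xs) 2 ⟩
  suc (suc (count Q? xs))                      ∎)
  where
  open ≤-Reasoning
  xs : List (Fin N)
  xs = allFinList N
  𝟙P 𝟙Q : Fin N → ℕ
  𝟙P x = 𝟙 (P? x)
  𝟙Q x = 𝟙 (Q? x)
  is : Fin N → Fin N → ℕ
  is z x = 𝟙 (x ≟F z)
  at-least-one : ∀ {x} → Q x ⊎ (x ≡ a ⊎ x ≡ b) → 1 ≤ 𝟙Q x + (is a x + is b x)
  at-least-one {x} (inj₁ q)        = ≤-trans (𝟙-holds (Q? x) q) (m≤m+n _ _)
  at-least-one {x} (inj₂ (inj₁ e)) = ≤-trans (𝟙-holds (x ≟F a) e) (≤-trans (m≤m+n (is a x) (is b x)) (m≤n+m _ (𝟙Q x)))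
  at-least-one {x} (inj₂ (inj₂ e)) = ≤-trans (𝟙-holds (x ≟F b) e) (≤-trans (m≤n+m (is b x) (is a x)) (m≤n+m _ (𝟙Q x)))
  weights : ∀ x → 𝟙P x + is m x ≤ 𝟙Q x + (is a x + is b x)
  weights x with P? x | x ≟F m
  ... | no _  | no _     = z≤n
  ... | yes p | no _     = at-least-one (P⇒Q∨ab p)
  ... | no _  | yes refl = at-least-one (inj₁ Qm)
  ... | yes p | yes refl with Pm⇒ab p
  ...   | inj₁ e = +-mono-≤ (𝟙-holds (Q? x) Qm) (≤-trans (𝟙-holds (x ≟F a) e) (m≤m+n _ _))
  ...   | inj₂ e = +-mono-≤ (𝟙-holds (Q? x) Qm) (≤-trans (𝟙-holds (x ≟F b) e) (m≤n+m _ _))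

-- The number of cycles of a function on Fin N, counted by orbit minima;
-- numCycles π is #cycles (π ⟨$⟩ʳ_) by definition.
#cycles : ∀ {N} → (Fin N → Fin N) → ℕ
#cycles {N} f = count (isOrbitMin? f) (allFinList N)

orbitMin-outside : ∀ {N} (f g : Fin N → Fin N) (S : List (Fin N)) →
  (∀ {y} → f y ∈ S → y ∈ S) → (∀ {x} → x ∉ S → g x ≡ f x) →
  ∀ {x} → x ∉ S → IsOrbitMin g x → IsOrbitMin f x
orbitMin-outside f g S closed agree {x} x∉S x-min k =
  subst (λ y → toℕ x ≤ toℕ y) (iter-agree f g S closed agree (toℕ k) x∉S) (x-min k)

#cycles-ext : ∀ {N} (f g : Fin N → Fin N) → (∀ x → g x ≡ f x) → #cycles g ≡ #cycles f
#cycles-ext {N} f g g≗f = cong length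
  (filter-≐ (isOrbitMin? g) (isOrbitMin? f)
    ( orbitMin-outside f g [] (λ ()) (λ {x} _ → g≗f x) (λ ())
    , orbitMin-outside g f [] (λ ()) (λ {x} _ → sym (g≗f x)) (λ ()))
    (allFinList N))

-- Every orbit minimum of g is one of f outside S, and the
-- minimum of C₁ or of C₂ inside S; the minimum of D is lost.
rearrangement-adds-at-most-one-cycle : ∀ {N} (f g : Fin N → Fin N) (S : List (Fin N))
  {D C₁ C₂ : List (Fin N)} →
  (∀ {y} → f y ∈ S → y ∈ S) → (∀ {x} → x ∉ S → g x ≡ f x) →
  IsCycle f D → D ⊆ S → IsCycle g C₁ → IsCycle g C₂ → (∀ {z} → z ∈ S → z ∈ C₁ ⊎ z ∈ C₂) →
  #cycles g ≤ suc (#cycles f)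
rearrangement-adds-at-most-one-cycle f g S closed agree cycD D⊆S cyc₁ cyc₂ S⊆C₁∪C₂
  with cycle-minimum f cycD | cycle-minimum g cyc₁ | cycle-minimum g cyc₂
... | m , m-min | a , a-min | b , b-min =
  count-exchange (isOrbitMin? g) (isOrbitMin? f) new-minimum
    (minimum-is-orbitMin f cycD m-min) (inside (D⊆S (proj₁ m-min)))
  where
  inside : ∀ {x} → x ∈ S → IsOrbitMin g x → x ≡ a ⊎ x ≡ b
  inside x∈S x-min with S⊆C₁∪C₂ x∈S
  ... | inj₁ x∈C₁ = inj₁ (orbitMin-on-cycle g cyc₁ a-min x∈C₁ x-min)
  ... | inj₂ x∈C₂ = inj₂ (orbitMin-on-cycle g cyc₂ b-min x∈C₂ x-min)
  new-minimum : ∀ {x} → IsOrbitMin g x → IsOrbitMin f x ⊎ (x ≡ a ⊎ x ≡ b)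
  new-minimum {x} x-min with any? (x ≟F_) S
  ... | yes x∈S = inj₂ (inside x∈S x-min)
  ... | no x∉S  = inj₁ (orbitMin-outside f g S closed agree x∉S x-min)

cycles-preimage-closed : ∀ {N} (π : Permutation′ N) {C₁ C₂} →
  IsCycle (π ⟨$⟩ʳ_) C₁ → IsCycle (π ⟨$⟩ʳ_) C₂ → ∀ {y} → π ⟨$⟩ʳ y ∈ C₁ ++ C₂ → y ∈ C₁ ++ C₂
cycles-preimage-closed π {C₁} cyc₁ cyc₂ πy∈ with ∈-++⁻ C₁ πy∈
... | inj₁ πy∈C₁ = ∈-++⁺ˡ (cycle-preimage (π ⟨$⟩ʳ_) (permutation-injective π) cyc₁ πy∈C₁)
... | inj₂ πy∈C₂ = ∈-++⁺ʳ C₁ (cycle-preimage (π ⟨$⟩ʳ_) (permutation-injective π) cyc₂ πy∈C₂)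

preflip-⊆ : ∀ {n} {ω : Sec n → _} {i I j J I′ J′ ω₁} → PreFlip {n} ω i I j J I′ J′ ω₁ → I ⊆ I′ × J ⊆ J′
preflip-⊆ (inj₁ (refl , refl , _))        = (λ p → p) , (λ p → p)
preflip-⊆ (inj₂ (inj₁ (refl , refl , _))) = reverse⁺ , (λ p → p)
preflip-⊆ (inj₂ (inj₂ (refl , refl , _))) = (λ p → p) , reverse⁺

-- For a gluing S is the
-- union of the two old cycles and the glued cycle covers it; for a slicing or
-- a half-flipping S is the old cycle, covered by the one or two new cycles.
vertices-after-reversal : ∀ {n} {G G′ : Fatgraph n} → Reversal G G′ →
  numCycles (σ G′) ≤ suc (numCycles (σ G))
vertices-after-reversal {n} {G} {G′} (gluing i j I J I′ J′ _ _ cycI cycJ _ preflip _ cycNew (agree , _)) =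
  rearrangement-adds-at-most-one-cycle (σ G ⟨$⟩ʳ_) (σ G′ ⟨$⟩ʳ_) (i ∷ I ++ j ∷ J)
    (cycles-preimage-closed (σ G) cycI cycJ) (agree _) cycI ∈-++⁺ˡ cycNew cycNew (λ p → inj₁ (merged p))
  where
  I⊆I′ : I ⊆ I′
  I⊆I′ = proj₁ (preflip-⊆ {n} preflip)
  J⊆J′ : J ⊆ J′
  J⊆J′ = proj₂ (preflip-⊆ {n} preflip)
  merged : i ∷ I ++ j ∷ J ⊆ i ∷ J′ ++ j ∷ I′
  merged (here e) = here e
  merged (there p) with ∈-++⁻ I p
  ... | inj₁ z∈I         = there (∈-++⁺ʳ J′ (there (I⊆I′ z∈I)))
  ... | inj₂ (here e)    = there (∈-++⁺ʳ J′ (here e))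
  ... | inj₂ (there z∈J) = there (∈-++⁺ˡ (J⊆J′ z∈J))
vertices-after-reversal {G = G} {G′} (slicing i j I J _ cycOld _ cycI cycJ (agree , _)) =
  rearrangement-adds-at-most-one-cycle (σ G ⟨$⟩ʳ_) (σ G′ ⟨$⟩ʳ_) (i ∷ J ++ j ∷ I)
    (cycle-preimage (σ G ⟨$⟩ʳ_) (permutation-injective (σ G)) cycOld) (agree _)
    cycOld (λ p → p) cycI cycJ split
  where
  split : ∀ {z} → z ∈ i ∷ J ++ j ∷ I → z ∈ i ∷ I ⊎ z ∈ j ∷ J
  split (here e) = inj₁ (here e)
  split (there p) with ∈-++⁻ J p
  ... | inj₁ z∈J         = inj₂ (there z∈J)
  ... | inj₂ (here e)    = inj₂ (here e)
  ... | inj₂ (there z∈I) = inj₁ (there z∈I)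
vertices-after-reversal {G = G} {G′} (half-flipping i j I J _ cycOld _ cycNew (agree , _)) =
  rearrangement-adds-at-most-one-cycle (σ G ⟨$⟩ʳ_) (σ G′ ⟨$⟩ʳ_) (i ∷ J ++ j ∷ I)
    (cycle-preimage (σ G ⟨$⟩ʳ_) (permutation-injective (σ G)) cycOld) (agree _)
    cycOld (λ p → p) cycNew cycNew (λ p → inj₁ (∷⁺ʳ i (++⁺ˡ (j ∷ I) reverse⁺) p))

boundaries-after-reversal : ∀ {n} {G G′ : Fatgraph n} → Reversal G G′ →
  numCycles (γ G′) ≡ numCycles (γ G)
boundaries-after-reversal {G = G} {G′} r = #cycles-ext (γ G ⟨$⟩ʳ_) (γ G′ ⟨$⟩ʳ_) (same-γ r)
  where
  same-γ : Reversal G G′ → ∀ x → γ G′ ⟨$⟩ʳ x ≡ γ G ⟨$⟩ʳ x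
  same-γ (gluing _ _ _ _ _ _ _ _ _ _ _ _ _ _ (_ , γ′≗γ , _)) = γ′≗γ
  same-γ (slicing _ _ _ _ _ _ _ _ _ (_ , γ′≗γ , _))         = γ′≗γ
  same-γ (half-flipping _ _ _ _ _ _ _ _ (_ , γ′≗γ , _))     = γ′≗γ

-- The Euler genus 2 - v + e - b in terms of vertices, ribbons and boundaries;
-- genus G is eulerGenus (numCycles (σ G)) n (numCycles (γ G)) by definition.
eulerGenus : ℕ → ℕ → ℕ → ℤ
eulerGenus v e b = ((ℤ.+ 2 ℤ.- ℤ.+ v) ℤ.+ ℤ.+ e) ℤ.- ℤ.+ b

eulerGenus-step : ∀ v v′ e b → v′ ≤ suc v → eulerGenus v e b ℤ.≤ ℤ.+ 1 ℤ.+ eulerGenus v′ e b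
eulerGenus-step v v′ e b v′≤1+v = begin
  eulerGenus v e b                             ≡⟨ split-off (ℤ.+ 1) (ℤ.+ 2) (ℤ.+ v) (ℤ.+ e) (ℤ.+ b) ⟩
  rest ℤ.+ (ℤ.+ 1 ℤ.- (ℤ.+ 1 ℤ.+ ℤ.+ v))      ≤⟨ ℤP.+-monoʳ-≤ rest (ℤP.+-monoʳ-≤ (ℤ.+ 1) (ℤP.neg-mono-≤ (ℤ.+≤+ v′≤1+v))) ⟩
  rest ℤ.+ (ℤ.+ 1 ℤ.- ℤ.+ v′)                  ≡⟨ join (ℤ.+ 1) (ℤ.+ 2) (ℤ.+ v′) (ℤ.+ e) (ℤ.+ b) ⟩
  ℤ.+ 1 ℤ.+ eulerGenus v′ e b                  ∎
  where
  open ℤP.≤-Reasoning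
  rest : ℤ
  rest = (ℤ.+ 2 ℤ.+ ℤ.+ e) ℤ.- ℤ.+ b
  split-off : ∀ one two x y z → ((two ℤ.- x) ℤ.+ y) ℤ.- z ≡ ((two ℤ.+ y) ℤ.- z) ℤ.+ (one ℤ.- (one ℤ.+ x))
  split-off = solve-∀
  join : ∀ one two x y z → ((two ℤ.+ y) ℤ.- z) ℤ.+ (one ℤ.- x) ≡ one ℤ.+ (((two ℤ.- x) ℤ.+ y) ℤ.- z)
  join = solve-∀

genus-after-reversal : ∀ {n} {G G′ : Fatgraph n} → Reversal G G′ → genus G ℤ.≤ ℤ.+ 1 ℤ.+ genus G′
genus-after-reversal {n} {G} {G′} r =
  subst (λ b → genus G ℤ.≤ ℤ.+ 1 ℤ.+ eulerGenus (numCycles (σ G′)) n b)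
    (sym (boundaries-after-reversal r))
    (eulerGenus-step (numCycles (σ G)) (numCycles (σ G′)) n (numCycles (γ G)) (vertices-after-reversal r))

genus-after-reversals : ∀ {n k} {G H : Fatgraph n} → Reversals k G H → genus G ℤ.≤ ℤ.+ k ℤ.+ genus H
genus-after-reversals done = ℤP.≤-reflexive (sym (ℤP.+-identityˡ _))
genus-after-reversals {k = suc k} {G} {H} (step {G' = G′} r rs) = begin
  genus G                          ≤⟨ genus-after-reversal r ⟩
  ℤ.+ 1 ℤ.+ genus G′               ≤⟨ ℤP.+-monoʳ-≤ (ℤ.+ 1) (genus-after-reversals rs) ⟩
  ℤ.+ 1 ℤ.+ (ℤ.+ k ℤ.+ genus H)    ≡⟨ sym (ℤP.+-assoc (ℤ.+ 1) (ℤ.+ k) (genus H)) ⟩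
  ℤ.+ suc k ℤ.+ genus H            ∎
  where open ℤP.≤-Reasoning

corollary1 : ∀ (n : ℕ) (G : Fatgraph n) → IsUnicellular G →
    RDistanceAtLeast G (genus G)
corollary1 n G _ k H reversals _ genusH≡0 = begin
  genus G              ≤⟨ genus-after-reversals reversals ⟩
  ℤ.+ k ℤ.+ genus H    ≡⟨ cong (ℤ._+_ (ℤ.+ k)) genusH≡0 ⟩
  ℤ.+ k ℤ.+ ℤ.+ 0      ≡⟨ ℤP.+-identityʳ (ℤ.+ k) ⟩
  ℤ.+ k                ∎
  where open ℤP.≤-Reasoning
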